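{- For all size-annotated types $T$ and $U$, $T\le U$ holds if and only if $T\le_{\mathrm a}U$ holds, where $\le$ is the relation inductively defined by the rules (size), (prod), (refl), (trans) below, and $\le_{\mathrm a}$ is the relation inductively defined by the rules (size) and (prod) only: (size) if $a\preceq_\infty b$ then $\mathsf B_a\le\mathsf B_b$; (prod) if $U'\le U$ and $V\le V'$ then $U\Rightarrow V\le U'\Rightarrow V'$; (refl) $T\le T$; (trans) if $T\le U$ and $U\le V$ then $T\le V$.
   Context: A size algebra consists (in particular) of a set $\mathcal A$ of first-order terms (size expressions) built from size variables and size function symbols, equipped with a quasi-order (reflexive and transitive relation) $\preceq$. Let $\bar{\mathcal A}=\mathcal A\cup\{\infty\}$ with $\infty\notin\mathcal A$, and $a\preceq_\infty b$ iff $a\preceq b$ or $b=\infty$. Given a nonempty set $\mathbb S$ of sorts, the size-annotated types are generated by: $\mathsf B_a$ for $\mathsf B\in\mathbb S$ and $a\in\bar{\mathcal A}$ (where the plain sort $\mathsf B$ is identified with $\mathsf B_\infty$), and $U\Rightarrow V$ for annotated types $U,V$. -}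

module Defs where

open import Level using (Level; _⊔_; suc)
open import Relation.Binary.Core using (Rel)
open import Relation.Binary.PropositionalEquality using (_≡_)
open import Relation.Binary.Structures using (IsPreorder)

data Ā {a} (A : Set a) : Set a where
  size : A → Ā A
  ∞    : Ā A

module _ {a ℓ} {A : Set a} (_≼_ : Rel A ℓ) where

  data _≼∞_ : Ā A → Ā A → Set (a ⊔ ℓ) where
    fin : ∀ {x y} → x ≼ y → size x ≼∞ size y
    inf : ∀ {x} → x ≼∞ ∞

-- Size-annotated types over sorts S and size terms A.
-- The plain sort B is B_∞, i.e.  base B ∞.
data Ty {s a} (S : Set s) (A : Set a) : Set (s ⊔ a) where
  base : S → Ā A → Ty S A
  _⇒_  : Ty S A → Ty S A → Ty S A

module _ {s a ℓ} {S : Set s} {A : Set a} (_≼_ : Rel A ℓ) where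

  data _≤_ : Ty S A → Ty S A → Set (s ⊔ a ⊔ ℓ) where
    size  : ∀ {B x y} → _≼∞_ _≼_ x y → base B x ≤ base B y
    prod  : ∀ {U U′ V V′} → U′ ≤ U → V ≤ V′ → (U ⇒ V) ≤ (U′ ⇒ V′)
    refl  : ∀ {T} → T ≤ T
    trans : ∀ {T U V} → T ≤ U → U ≤ V → T ≤ V

  data _≤ₐ_ : Ty S A → Ty S A → Set (s ⊔ a ⊔ ℓ) where
    size : ∀ {B x y} → _≼∞_ _≼_ x y → base B x ≤ₐ base B y
    prod : ∀ {U U′ V V′} → U′ ≤ₐ U → V ≤ₐ V′ → (U ⇒ V) ≤ₐ (U′ ⇒ V′)

module Submission where

-- Every ≤ₐ rule is a ≤ rule, so ≤ₐ ⊆ ≤ by a direct translation.  For the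
-- converse it suffices that ≤ₐ admits the two missing rules: it is
-- reflexive (by induction on the type) and transitive (by induction on the
-- derivations; a size step only meets a size step and a prod step only a
-- prod step, the domain part composing contravariantly).

open import Defs
open import Level using (_⊔_)
open import Relation.Binary.Core using (Rel)
open import Relation.Binary.Definitions using (Reflexive; Transitive)
open import Relation.Binary.PropositionalEquality using (_≡_)
open import Relation.Binary.Structures using (IsPreorder)
open import Function.Bundles using (_⇔_; mk⇔)

module ExtendedSize {a ℓ} {A : Set a} (_≼_ : Rel A ℓ) where

  ≼∞-refl : Reflexive _≼_ → Reflexive (_≼∞_ _≼_)
  ≼∞-refl ≼-refl {size x} = fin ≼-refl
  ≼∞-refl ≼-refl {∞}      = inf

  ≼∞-trans : Transitive _≼_ → Transitive (_≼∞_ _≼_)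
  ≼∞-trans ≼-trans (fin x≼y) (fin y≼z) = fin (≼-trans x≼y y≼z)
  ≼∞-trans ≼-trans _         inf       = inf

module Subtyping {s a ℓ} {S : Set s} {A : Set a}
                 (_≼_ : Rel A ℓ) (≼-preorder : IsPreorder _≡_ _≼_) where

  open IsPreorder ≼-preorder using () renaming (refl to ≼-refl; trans to ≼-trans)
  open ExtendedSize _≼_

  infix 4 _≤ᵈ_ _≤ᵃ_

  _≤ᵈ_ _≤ᵃ_ : Rel (Ty S A) (s ⊔ a ⊔ ℓ)
  _≤ᵈ_ = _≤_ _≼_
  _≤ᵃ_ = _≤ₐ_ _≼_

  ≤ₐ-refl : (T : Ty S A) → T ≤ᵃ T
  ≤ₐ-refl (base B x) = size (≼∞-refl ≼-refl)
  ≤ₐ-refl (T ⇒ U)    = prod (≤ₐ-refl T) (≤ₐ-refl U)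

  -- (trans) is admissible for ≤ₐ: the rules are syntax-directed, so the two
  -- derivations end in the same rule and compose componentwise.
  ≤ₐ-trans : ∀ {T U V} → T ≤ᵃ U → U ≤ᵃ V → T ≤ᵃ V
  ≤ₐ-trans (size x≼y) (size y≼z) = size (≼∞-trans ≼-trans x≼y y≼z)
  ≤ₐ-trans (prod U₂≤U₁ V₁≤V₂) (prod U₃≤U₂ V₂≤V₃) =
    prod (≤ₐ-trans U₃≤U₂ U₂≤U₁) (≤ₐ-trans V₁≤V₂ V₂≤V₃)

  ≤⇒≤ₐ : ∀ {T U} → T ≤ᵈ U → T ≤ᵃ U
  ≤⇒≤ₐ (size x≼y)       = size x≼y
  ≤⇒≤ₐ (prod U′≤U V≤V′) = prod (≤⇒≤ₐ U′≤U) (≤⇒≤ₐ V≤V′)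
  ≤⇒≤ₐ {T} refl         = ≤ₐ-refl T
  ≤⇒≤ₐ (trans T≤U U≤V)  = ≤ₐ-trans (≤⇒≤ₐ T≤U) (≤⇒≤ₐ U≤V)

  ≤ₐ⇒≤ : ∀ {T U} → T ≤ᵃ U → T ≤ᵈ U
  ≤ₐ⇒≤ (size x≼y)       = size x≼y
  ≤ₐ⇒≤ (prod U′≤U V≤V′) = prod (≤ₐ⇒≤ U′≤U) (≤ₐ⇒≤ V≤V′)

mainTheorem4 : ∀ {s a ℓ} (S : Set s) (A : Set a) (_≼_ : Rel A ℓ)
    → IsPreorder _≡_ _≼_ → S
    → (T U : Ty S A) → (_≤_ _≼_ T U ⇔ _≤ₐ_ _≼_ T U)
mainTheorem4 S A _≼_ ≼-preorder _ T U = mk⇔ ≤⇒≤ₐ ≤ₐ⇒≤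
  where open Subtyping {S = S} _≼_ ≼-preorder
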